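{- Let $G=(V,E)$ be a graph with maximum degree $\Delta(G)$, $L\subseteq V$ a set of landmarks, $H$ the neighborhood kernel, and $(H_c=(V_c,E_c),\phi)$ the compact neighborhood kernel constructed from $H$ as described below. Then for every $v\in V_c$, $\deg^-_{H_c}(v)\le \deg^-_H(v)\le\Delta(G)$.
   Context: Graphs are finite, simple, undirected; $d(v,L)=\min_{u\in L}d_G(v,u)$; every vertex is reachable from $L$. The neighborhood kernel $H$ is the digraph on $V$ with arc set $\{(v,w): vw\in E,\ d(v,L)+1=d(w,L)\}$; $\deg^-$ denotes in-degree. The compact neighborhood kernel is obtained from $H$ by processing the vertices of $V$ in order of nondecreasing $d(v,L)$ and, whenever the current vertex $v$ has exactly one in-neighbor $w$ in the current digraph, contracting the arc $(w,v)$ into $w$ (so $v$ is added to the bag of $w$). The final digraph is $H_c=(V_c,E_c)$ with $V_c\subseteq V$ the surviving vertices, and $\phi(x)$ is the set of original vertices merged into $x$. -}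

module Defs where

open import Data.Bool using (Bool; true; false; _∧_; _∨_; if_then_else_)
open import Data.Nat using (ℕ; zero; suc; _+_; _⊔_; _≡ᵇ_)
open import Data.Fin using (Fin; _≟_)
open import Data.List using (List; []; _∷_; map; foldr; foldl; allFin; filterᵇ)
open import Data.Bool.ListAction using (any)
open import Relation.Binary.PropositionalEquality using (_≡_)
open import Relation.Nullary.Decidable using (⌊_⌋)

record Graph (n : ℕ) : Set where
  field
    adj     : Fin n → Fin n → Bool
    adj-sym : ∀ u v → adj u v ≡ adj v u
    adj-irr : ∀ v → adj v v ≡ false
open Graph public

count : {A : Set} → (A → Bool) → List A → ℕ
count p []       = 0
count p (x ∷ xs) = (if p x then 1 else 0) + count p xs

deg : ∀ {n} → Graph n → Fin n → ℕ
deg {n} G v = count (adj G v) (allFin n)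

maxDeg : ∀ {n} → Graph n → ℕ
maxDeg {n} G = foldr _⊔_ 0 (map (deg G) (allFin n))

-- L ⊆ V as a boolean membership predicate.
-- reach G L k v = true iff some landmark is at graph distance ≤ k from v.
reach : ∀ {n} → Graph n → (Fin n → Bool) → ℕ → Fin n → Bool
reach G L zero    v = L v
reach {n} G L (suc k) v = reach G L k v ∨ any (λ u → adj G v u ∧ reach G L k u) (allFin n)

-- least k ≤ m with p k = true (m if none)
least : (ℕ → Bool) → ℕ → ℕ
least p zero    = zero
least p (suc m) = if p zero then zero else suc (least (λ k → p (suc k)) m)

-- d(v, L) = min over u ∈ L of d_G(v,u); for reachable v this is < n.
dist : ∀ {n} → Graph n → (Fin n → Bool) → Fin n → ℕ
dist {n} G L v = least (λ k → reach G L k v) n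

hArc : ∀ {n} → Graph n → (Fin n → Bool) → Fin n → Fin n → Bool
hArc G L v w = adj G v w ∧ (suc (dist G L v) ≡ᵇ dist G L w)

-- A digraph on a subset of Fin n together with the bags φ.
record KState (n : ℕ) : Set where
  field
    alive : Fin n → Bool
    arc   : Fin n → Fin n → Bool      -- only meaningful between alive vertices
    bag   : Fin n → List (Fin n)
open KState public

_==_ : ∀ {n} → Fin n → Fin n → Bool
a == b = ⌊ a ≟ b ⌋

inNbrs : ∀ {n} → KState n → Fin n → List (Fin n)
inNbrs {n} S v = filterᵇ (λ u → alive S u ∧ arc S u v) (allFin n)

contract : ∀ {n} → KState n → Fin n → Fin n → KState n
contract S w v = record
  { alive = λ a → alive S a ∧ (if a == v then false else true)
  ; arc   = λ a b → arc S a b ∨ ((a == w) ∧ arc S v b)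
  ; bag   = λ a → if a == w then foldr _∷_ (bag S v) (bag S w) else bag S a
  }

step : ∀ {n} → KState n → Fin n → KState n
step S v with alive S v | inNbrs S v
... | true | w ∷ [] = contract S w v
... | _    | _      = S

initial : ∀ {n} → Graph n → (Fin n → Bool) → KState n
initial G L = record
  { alive = λ _ → true
  ; arc   = hArc G L
  ; bag   = λ v → v ∷ []
  }

compactKernel : ∀ {n} → Graph n → (Fin n → Bool) → List (Fin n) → KState n
compactKernel G L ord = foldl step (initial G L) ord

indegH : ∀ {n} → Graph n → (Fin n → Bool) → Fin n → ℕ
indegH {n} G L v = count (λ u → hArc G L u v) (allFin n)

indegK : ∀ {n} → KState n → Fin n → ℕ
indegK {n} S v = count (λ u → alive S u ∧ arc S u v) (allFin n)

-- Contracting an arc (w, v) into w redirects the out-arcs of v to w and deletes v, so every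
-- remaining vertex b trades the in-neighbour v for at most the one in-neighbour w. Hence no
-- contraction raises an in-degree, whatever the processing order, and the compact kernel
-- inherits the bound from H, where in-neighbours of v are in particular G-neighbours of v.
module Submission where

open import Defs
open import Data.Bool using (Bool; true; false; _∧_; _∨_; not; if_then_else_)
open import Data.Bool.Properties using (∧-identityʳ; ∧-zeroʳ; ∧-comm)
open import Data.Nat using (ℕ; suc; _+_; _≤_; _⊔_; _≡ᵇ_; z≤n; s≤s)
open import Data.Nat.Properties
  using (≤-refl; ≤-trans; +-mono-≤; +-identityʳ; m≤m⊔n; m≤n⊔m; +-commutativeSemigroup; module ≤-Reasoning)
open import Data.Fin using (Fin; _≟_) renaming (zero to fz; suc to fs)
open import Data.List using (List; []; _∷_; allFin; map; foldr; foldl)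
open import Data.List.Properties using (map-tabulate)
open import Data.List.Membership.Propositional using (_∈_)
open import Data.List.Membership.Propositional.Properties using (∈-allFin)
open import Data.List.Relation.Unary.Any using (here; there)
open import Data.List.Relation.Binary.Permutation.Propositional using (_↭_)
open import Data.List.Relation.Unary.Linked using (Linked)
open import Data.Product using (_×_; ∃; _,_)
open import Function using (id; _∘_)
open import Relation.Binary.PropositionalEquality using (_≡_; refl; sym; trans; cong; cong₂; module ≡-Reasoning)
open import Relation.Nullary using (yes; no)

open import Algebra.Properties.CommutativeSemigroup +-commutativeSemigroup
  using () renaming (interchange to +-interchange)

⟦_⟧ : Bool → ℕ
⟦ b ⟧ = if b then 1 else 0

⟦∧⟧≤⟦⟧ : ∀ x y → ⟦ x ∧ y ⟧ ≤ ⟦ x ⟧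
⟦∧⟧≤⟦⟧ false y = z≤n
⟦∧⟧≤⟦⟧ true false = z≤n
⟦∧⟧≤⟦⟧ true true = ≤-refl

⟦⟧-split : ∀ x e → ⟦ x ⟧ ≡ ⟦ x ∧ not e ⟧ + ⟦ x ∧ e ⟧
⟦⟧-split false e = refl
⟦⟧-split true false = refl
⟦⟧-split true true = refl

module _ {A : Set} where

  count-cong : ∀ {p q : A → Bool} (xs : List A) → (∀ a → p a ≡ q a) → count p xs ≡ count q xs
  count-cong [] p≡q = refl
  count-cong (x ∷ xs) p≡q = cong₂ _+_ (cong ⟦_⟧ (p≡q x)) (count-cong xs p≡q)

  count-false : ∀ (xs : List A) → count (λ _ → false) xs ≡ 0
  count-false [] = refl
  count-false (x ∷ xs) = count-false xs

  count-mono : ∀ {p q : A → Bool} (xs : List A)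
    → (∀ a → ⟦ p a ⟧ ≤ ⟦ q a ⟧) → count p xs ≤ count q xs
  count-mono [] p≤q = z≤n
  count-mono (x ∷ xs) p≤q = +-mono-≤ (p≤q x) (count-mono xs p≤q)

  count-≤-+ : ∀ {p q r : A → Bool} (xs : List A)
    → (∀ a → ⟦ p a ⟧ ≤ ⟦ q a ⟧ + ⟦ r a ⟧) → count p xs ≤ count q xs + count r xs
  count-≤-+ [] p≤q+r = z≤n
  count-≤-+ {p} {q} {r} (x ∷ xs) p≤q+r = begin
    ⟦ p x ⟧ + count p xs                                 ≤⟨ +-mono-≤ (p≤q+r x) (count-≤-+ xs p≤q+r) ⟩
    (⟦ q x ⟧ + ⟦ r x ⟧) + (count q xs + count r xs)      ≡⟨ +-interchange (⟦ q x ⟧) (⟦ r x ⟧) (count q xs) (count r xs) ⟩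
    (⟦ q x ⟧ + count q xs) + (⟦ r x ⟧ + count r xs)      ∎
    where open ≤-Reasoning

  count-≡-+ : ∀ {p q r : A → Bool} (xs : List A)
    → (∀ a → ⟦ p a ⟧ ≡ ⟦ q a ⟧ + ⟦ r a ⟧) → count p xs ≡ count q xs + count r xs
  count-≡-+ [] p≡q+r = refl
  count-≡-+ {q = q} {r} (x ∷ xs) p≡q+r =
    trans (cong₂ _+_ (p≡q+r x) (count-≡-+ xs p≡q+r))
          (+-interchange (⟦ q x ⟧) (⟦ r x ⟧) (count q xs) (count r xs))

  count-map : ∀ {B : Set} (p : B → Bool) (f : A → B) (xs : List A)
    → count p (map f xs) ≡ count (p ∘ f) xs
  count-map p f [] = refl
  count-map p f (x ∷ xs) = cong (⟦ p (f x) ⟧ +_) (count-map p f xs)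

count-allFin-suc : ∀ {n} (p : Fin (suc n) → Bool)
  → count p (allFin (suc n)) ≡ ⟦ p fz ⟧ + count (p ∘ fs) (allFin n)
count-allFin-suc {n} p =
  cong (⟦ p fz ⟧ +_) (trans (cong (count p) (sym (map-tabulate id fs))) (count-map p fs (allFin n)))

fs==fs : ∀ {n} (a b : Fin n) → (fs a == fs b) ≡ (a == b)
fs==fs a b with a ≟ b
... | yes refl = refl
... | no _ = refl

count-∧-== : ∀ {n} (g : Fin n → Bool) (x : Fin n) → count (λ a → g a ∧ (a == x)) (allFin n) ≡ ⟦ g x ⟧
count-∧-== {suc n} g fz = begin
  count (λ a → g a ∧ (a == fz)) (allFin (suc n))        ≡⟨ count-allFin-suc (λ a → g a ∧ (a == fz)) ⟩
  ⟦ g fz ∧ true ⟧ + count (λ a → g (fs a) ∧ false) (allFin n)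
    ≡⟨ cong₂ _+_ (cong ⟦_⟧ (∧-identityʳ (g fz)))
                 (trans (count-cong (allFin n) (∧-zeroʳ ∘ g ∘ fs)) (count-false (allFin n))) ⟩
  ⟦ g fz ⟧ + 0                                           ≡⟨ +-identityʳ _ ⟩
  ⟦ g fz ⟧                                               ∎
  where open ≡-Reasoning
count-∧-== {suc n} g (fs x) = begin
  count (λ a → g a ∧ (a == fs x)) (allFin (suc n))      ≡⟨ count-allFin-suc (λ a → g a ∧ (a == fs x)) ⟩
  ⟦ g fz ∧ false ⟧ + count (λ a → g (fs a) ∧ (fs a == fs x)) (allFin n)
    ≡⟨ cong₂ _+_ (cong ⟦_⟧ (∧-zeroʳ (g fz)))
                 (count-cong (allFin n) (λ a → cong (g (fs a) ∧_) (fs==fs a x))) ⟩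
  count (λ a → g (fs a) ∧ (a == x)) (allFin n)           ≡⟨ count-∧-== (g ∘ fs) x ⟩
  ⟦ g (fs x) ⟧                                           ∎
  where open ≡-Reasoning

-- The in-arc indicator of a at b after contract S w v, with x, e, y, e′, z standing for
-- alive S a, a == v, arc S a b, a == w, arc S v b.
⟦contract-arc⟧-≤ : ∀ x e y e′ z
  → ⟦ (x ∧ (if e then false else true)) ∧ (y ∨ (e′ ∧ z)) ⟧ ≤ ⟦ (x ∧ y) ∧ not e ⟧ + ⟦ z ∧ e′ ⟧
⟦contract-arc⟧-≤ false e y e′ z = z≤n
⟦contract-arc⟧-≤ true true y e′ z = z≤n
⟦contract-arc⟧-≤ true false true e′ z = s≤s z≤n
⟦contract-arc⟧-≤ true false false e′ z rewrite ∧-comm e′ z = ≤-refl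

indegK-contract-≤ : ∀ {n} (S : KState n) (w v b : Fin n) → alive S v ≡ true
  → indegK (contract S w v) b ≤ indegK S b
indegK-contract-≤ {n} S w v b v-alive = begin
  indegK (contract S w v) b
    ≤⟨ count-≤-+ (allFin n) (λ a → ⟦contract-arc⟧-≤ (alive S a) (a == v) (arc S a b) (a == w) (arc S v b)) ⟩
  notV + count (λ a → arc S v b ∧ (a == w)) (allFin n)
    ≡⟨ cong (notV +_) (count-∧-== (λ _ → arc S v b) w) ⟩
  notV + ⟦ arc S v b ⟧
    ≡⟨ cong (λ t → notV + ⟦ t ∧ arc S v b ⟧) (sym v-alive) ⟩
  notV + ⟦ inArc v ⟧
    ≡⟨ cong (notV +_) (sym (count-∧-== inArc v)) ⟩
  notV + count (λ a → inArc a ∧ (a == v)) (allFin n)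
    ≡⟨ sym (count-≡-+ (allFin n) (λ a → ⟦⟧-split (inArc a) (a == v))) ⟩
  indegK S b ∎
  where
  open ≤-Reasoning
  inArc : Fin n → Bool
  inArc a = alive S a ∧ arc S a b
  notV : ℕ
  notV = count (λ a → inArc a ∧ not (a == v)) (allFin n)

indegK-step-≤ : ∀ {n} (S : KState n) (v b : Fin n) → indegK (step S v) b ≤ indegK S b
indegK-step-≤ S v b with alive S v in v-alive | inNbrs S v
... | true  | w ∷ []      = indegK-contract-≤ S w v b v-alive
... | true  | []          = ≤-refl
... | true  | _ ∷ _ ∷ _   = ≤-refl
... | false | _           = ≤-refl

indegK-foldl-step-≤ : ∀ {n} (S : KState n) (ord : List (Fin n)) (b : Fin n)
  → indegK (foldl step S ord) b ≤ indegK S b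
indegK-foldl-step-≤ S [] b = ≤-refl
indegK-foldl-step-≤ S (v ∷ ord) b = ≤-trans (indegK-foldl-step-≤ (step S v) ord b) (indegK-step-≤ S v b)

indegH-≤-deg : ∀ {n} (G : Graph n) (L : Fin n → Bool) v → indegH G L v ≤ deg G v
indegH-≤-deg {n} G L v = count-mono (allFin n) hArc≤adj
  where
  hArc≤adj : ∀ u → ⟦ hArc G L u v ⟧ ≤ ⟦ adj G v u ⟧
  hArc≤adj u rewrite adj-sym G v u = ⟦∧⟧≤⟦⟧ (adj G u v) (suc (dist G L u) ≡ᵇ dist G L v)

≤-foldr-⊔-map : ∀ {A : Set} (f : A → ℕ) {x : A} {xs : List A} → x ∈ xs → f x ≤ foldr _⊔_ 0 (map f xs)
≤-foldr-⊔-map f (here refl) = m≤m⊔n _ _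
≤-foldr-⊔-map f (there x∈xs) = ≤-trans (≤-foldr-⊔-map f x∈xs) (m≤n⊔m _ _)

deg-≤-maxDeg : ∀ {n} (G : Graph n) v → deg G v ≤ maxDeg G
deg-≤-maxDeg G v = ≤-foldr-⊔-map (deg G) (∈-allFin v)

lemmaA4 : ∀ {n} (G : Graph n) (L : Fin n → Bool)
    → (∀ v → ∃ λ k → reach G L k v ≡ true)
    → (ord : List (Fin n)) → ord ↭ allFin n
    → Linked (λ a b → dist G L a ≤ dist G L b) ord
    → ∀ v → alive (compactKernel G L ord) v ≡ true
    → (indegK (compactKernel G L ord) v ≤ indegH G L v) × (indegH G L v ≤ maxDeg G)
lemmaA4 G L _ ord _ _ v _ =
  indegK-foldl-step-≤ (initial G L) ord v , ≤-trans (indegH-≤-deg G L v) (deg-≤-maxDeg G v)
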